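{- Let $\varphi$ be a 3SAT formula on variables $x_1,\dots,x_n$, and let $(X,\mathcal{F})$ be the Avoider-Enforcer game constructed from $\varphi$ as described in the context, played with Enforcer making the first move. If Avoider plays according to a winning strategy, then in every play of the game, whenever Enforcer claims a vertex in some box $B_i$, Avoider's immediately following move claims a vertex in the same box $B_i$.
   Context: Avoider-Enforcer game: on a hypergraph $(X,\mathcal{F})$, Avoider and Enforcer alternately claim one previously unclaimed vertex of $X$ per move until all vertices are claimed; Avoider loses if she has claimed all vertices of some losing set $f\in\mathcal{F}$, and wins otherwise. Construction from a 3SAT formula $\varphi$ on variables $x_1,\dots,x_n$, each clause having the form $C=\ell_i\lor\ell_j\lor\ell_k$ with $\ell_h\in\{x_h,\overline{x_h}\}$ for $h=i,j,k$: the board $X$ consists of $4n$ vertices partitioned into boxes $B_i=\{a_i,s_i,x_i,\overline{x_i}\}$, $i=1,\dots,n$ (the vertices $x_i,\overline{x_i}$ are identified with the corresponding literals). The losing sets are: for each $i$, all four $3$-element subsets of $B_i$; and for each clause $C=\ell_i\lor\ell_j\lor\ell_k$ of $\varphi$, the set $L_C=\{s_i,s_j,s_k,\overline{\ell_i},\overline{\ell_j},\overline{\ell_k}\}$, where $\overline{\ell}$ denotes the negation of literal $\ell$ (with $\overline{\overline{x_h}}=x_h$). -}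

module Defs where

open import Data.Nat using (ℕ)
open import Data.Fin using (Fin; zero; suc)
open import Data.Bool using (Bool; true; false; not)
open import Data.Product using (_×_; _,_; proj₁)
open import Data.List using (List; []; _∷_; _++_; map; concatMap)
open import Data.List.Membership.Propositional using (_∈_; _∉_)
open import Data.List.Relation.Unary.All using (All)
open import Data.List.Relation.Unary.Any using (Any)
open import Relation.Nullary using (¬_)

-- Vertices of the board: (i , k) is the k-th vertex of box B_i, where
-- k = 0 : a_i,  k = 1 : s_i,  k = 2 : x_i,  k = 3 : x̄_i.
Vertex : ℕ → Set
Vertex n = Fin n × Fin 4

box : ∀ {n} → Vertex n → Fin n
box = proj₁

a s xv x̄v : ∀ {n} → Fin n → Vertex n
a  i = i , zero
s  i = i , suc zero
xv i = i , suc (suc zero)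
x̄v i = i , suc (suc (suc zero))

-- A literal: (h , true) is x_h, (h , false) is x̄_h.
Literal : ℕ → Set
Literal n = Fin n × Bool

negLit : ∀ {n} → Literal n → Literal n
negLit (h , b) = h , not b

litVertex : ∀ {n} → Literal n → Vertex n
litVertex (h , true)  = xv h
litVertex (h , false) = x̄v h

varOf : ∀ {n} → Literal n → Fin n
varOf = proj₁

Clause : ℕ → Set
Clause n = Literal n × Literal n × Literal n

Formula : ℕ → Set
Formula n = List (Clause n)

allIdx : (n : ℕ) → List (Fin n)
allIdx ℕ.zero    = []
allIdx (ℕ.suc n) = zero ∷ map suc (allIdx n)

boxTriples : ∀ {n} → Fin n → List (List (Vertex n))
boxTriples i =
  (s i ∷ xv i ∷ x̄v i ∷ []) ∷
  (a i ∷ xv i ∷ x̄v i ∷ []) ∷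
  (a i ∷ s i ∷ x̄v i ∷ []) ∷
  (a i ∷ s i ∷ xv i ∷ []) ∷ []

clauseSet : ∀ {n} → Clause n → List (Vertex n)
clauseSet (l₁ , l₂ , l₃) =
  s (varOf l₁) ∷ s (varOf l₂) ∷ s (varOf l₃) ∷
  litVertex (negLit l₁) ∷ litVertex (negLit l₂) ∷ litVertex (negLit l₃) ∷ []

losingSets : ∀ {n} → Formula n → List (List (Vertex n))
losingSets {n} φ = concatMap boxTriples (allIdx n) ++ map clauseSet φ

AvoiderLoses : ∀ {n} → Formula n → List (Vertex n) → Set
AvoiderLoses φ A = Any (λ f → All (_∈ A) f) (losingSets φ)

-- A play history is the list of claimed vertices in chronological order.
-- Enforcer moves first, so Avoider's moves are those at odd positions (0-based).
avoiderMoves : ∀ {A : Set} → List A → List A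
avoiderMoves []            = []
avoiderMoves (_ ∷ [])      = []
avoiderMoves (_ ∷ y ∷ r)   = y ∷ avoiderMoves r

-- A strategy for Avoider: maps the history (ending with Enforcer's move) to her move.
AvoiderStrategy : ℕ → Set
AvoiderStrategy n = List (Vertex n) → Vertex n

-- Histories reachable (after complete rounds) when Avoider follows σ and
-- Enforcer plays arbitrarily (legally): each round Enforcer claims an
-- unclaimed v, then Avoider answers σ (h ++ [v]).
data Reach {n} (σ : AvoiderStrategy n) : List (Vertex n) → Set where
  start : Reach σ []
  round : ∀ {h v} → Reach σ h → v ∉ h →
          Reach σ (h ++ v ∷ σ (h ++ v ∷ []) ∷ [])

LegalStrategy : ∀ {n} → AvoiderStrategy n → Set
LegalStrategy σ = ∀ h v → Reach σ h → v ∉ h → σ (h ++ v ∷ []) ∉ (h ++ v ∷ [])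

AvoiderWinning : ∀ {n} → Formula n → AvoiderStrategy n → Set
AvoiderWinning φ σ =
  LegalStrategy σ ×
  (∀ h → Reach σ h → (∀ v → v ∈ h) → ¬ AvoiderLoses φ (avoiderMoves h))

-- A player's count in a box B_k is the number of its vertices she has claimed.
-- Along every play consistent with a winning strategy σ the two players' counts
-- agree in every box and σ answers each Enforcer move in its own box; the two
-- facts are proved together, round by round. If Avoider answered a move in B_i
-- outside B_i, Enforcer would be ahead in B_i, and he stays ahead by claiming
-- vertices of B_i while there are any and arbitrary vertices afterwards. At the
-- end every box is full and Avoider, not having lost, holds at most 2 of its 4
-- vertices, hence no more than Enforcer; being strictly behind in B_i she holds
-- fewer vertices in total, although both players made the same number of moves.
module Submission where

open import Defs
open import Data.Nat using (ℕ; zero; suc; _+_; _≤_; _<_; z≤n; s≤s)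
open import Data.Nat.Properties
  using (+-0-commutativeMonoid; +-mono-≤; +-mono-<-≤; +-mono-≤-<; +-cancelˡ-≤; +-assoc; +-identityʳ;
         ≤-pred; ≤-trans; ≤-reflexive; ≤-antisym; _≤?_; ≰⇒>; <-irrefl; <⇒≱; m≤n+m; m<m+n)
open import Data.Fin using (Fin; zero; suc)
open import Data.Fin.Properties using (_≟_; all?; ¬∀⟶∃¬)
open import Data.Product using (_,_; proj₁; proj₂; ∃; Σ-syntax)
open import Data.Product.Properties using (≡-dec)
open import Data.Sum using (_⊎_; inj₁; inj₂; [_,_]′)
open import Data.Empty using (⊥; ⊥-elim)
open import Data.Bool using (if_then_else_)
open import Data.List using (List; []; _∷_; _++_)
open import Data.List.Membership.Propositional using (_∈_; _∉_; lose)
open import Data.List.Membership.Propositional.Properties using (∈-++⁺ˡ; ∈-++⁺ʳ; ∈-++⁻; ∈-map⁺)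
open import Data.List.Relation.Binary.Subset.Propositional using (_⊆_)
open import Data.List.Relation.Unary.Any using (Any; here; there)
open import Data.List.Relation.Unary.All using (All; []; _∷_)
open import Data.List.Relation.Unary.Any.Properties using (++⁺ˡ; concatMap⁺)
open import Algebra.Properties.CommutativeMonoid.Sum +-0-commutativeMonoid
  using (sum; sum-syntax; sum-cong-≗; ∑-distrib-+)
open import Function using (_∘_)
open import Relation.Nullary using (¬_; Dec; yes; no; does)
open import Relation.Unary using (Decidable)
open import Relation.Binary.Definitions using (DecidableEquality)
open import Relation.Binary.PropositionalEquality
  using (_≡_; _≢_; refl; sym; trans; cong; cong₂; subst; subst₂; module ≡-Reasoning)

open ≡-Reasoning

indicator : {P : Set} → Dec P → ℕ
indicator d = if does d then 1 else 0

indicator-yes : {P : Set} (d : Dec P) → P → indicator d ≡ 1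
indicator-yes (yes _) _  = refl
indicator-yes (no ¬p) p  = ⊥-elim (¬p p)

indicator-no : {P : Set} (d : Dec P) → ¬ P → indicator d ≡ 0
indicator-no (yes p) ¬p = ⊥-elim (¬p p)
indicator-no (no _)  _  = refl

indicator≤1 : {P : Set} (d : Dec P) → indicator d ≤ 1
indicator≤1 (yes _) = s≤s z≤n
indicator≤1 (no _)  = z≤n

indicator-mono : {P Q : Set} → (P → Q) → (p : Dec P) (q : Dec Q) → indicator p ≤ indicator q
indicator-mono P→Q (yes p) q = ≤-reflexive (sym (indicator-yes q (P→Q p)))
indicator-mono _   (no _)  _ = z≤n

indicator-mono-< : {P Q : Set} → ¬ P → Q → (p : Dec P) (q : Dec Q) → indicator p < indicator q
indicator-mono-< ¬p q (yes p) _  = ⊥-elim (¬p p)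
indicator-mono-< ¬p q (no _)  q? = ≤-reflexive (sym (indicator-yes q? q))

indicator-cong : {P Q : Set} → (P → Q) → (Q → P) → (p : Dec P) (q : Dec Q) → indicator p ≡ indicator q
indicator-cong P→Q Q→P p q = ≤-antisym (indicator-mono P→Q p q) (indicator-mono Q→P q p)

sum-mono-≤ : ∀ {m} {f g : Fin m → ℕ} → (∀ k → f k ≤ g k) → sum f ≤ sum g
sum-mono-≤ {zero}  _   = z≤n
sum-mono-≤ {suc m} f≤g = +-mono-≤ (f≤g zero) (sum-mono-≤ (f≤g ∘ suc))

sum-mono-< : ∀ {m} {f g : Fin m → ℕ} → (∀ k → f k ≤ g k) → ∀ p → f p < g p → sum f < sum g
sum-mono-< f≤g zero    fp<gp = +-mono-<-≤ fp<gp (sum-mono-≤ (f≤g ∘ suc))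
sum-mono-< f≤g (suc p) fp<gp = +-mono-≤-< (f≤g zero) (sum-mono-< (f≤g ∘ suc) p fp<gp)

sum-zero : ∀ {m} {f : Fin m → ℕ} → (∀ k → f k ≡ 0) → sum f ≡ 0
sum-zero {zero}  _  = refl
sum-zero {suc m} f≡0 = cong₂ _+_ (f≡0 zero) (sum-zero (f≡0 ∘ suc))

sum-indicator-≟ : ∀ {m} (p : Fin m) → ∑[ k < m ] indicator (k ≟ p) ≡ 1
sum-indicator-≟ {suc m} zero = cong suc (sum-zero {m} λ _ → refl)
sum-indicator-≟ (suc p)      = sum-indicator-≟ p

all-or-counterexample : ∀ {m} {P : Fin m → Set} → Decidable P → (∀ k → P k) ⊎ ∃ (¬_ ∘ P)
all-or-counterexample P? with all? P?
... | yes all  = inj₁ all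
... | no ¬all  = inj₂ (¬∀⟶∃¬ _ _ P? ¬all)

∈-allIdx : ∀ m (k : Fin m) → k ∈ allIdx m
∈-allIdx (suc m) zero    = here refl
∈-allIdx (suc m) (suc k) = there (∈-map⁺ suc (∈-allIdx m k))

boardSize : ℕ → ℕ
boardSize n = ∑[ k < n ] 4

module _ {n : ℕ} where

  _≟ᵛ_ : DecidableEquality (Vertex n)
  _≟ᵛ_ = ≡-dec _≟_ _≟_

  open import Data.List.Membership.DecPropositional _≟ᵛ_ using (_∈?_) public

  boxCount : List (Vertex n) → Fin n → ℕ
  boxCount L k = ∑[ j < 4 ] indicator ((k , j) ∈? L)

  totalCount : List (Vertex n) → ℕ
  totalCount L = ∑[ k < n ] boxCount L k

  totalCount≤boardSize : ∀ L → totalCount L ≤ boardSize n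
  totalCount≤boardSize L = sum-mono-≤ λ k → sum-mono-≤ λ j → indicator≤1 ((k , j) ∈? L)

  indicator-∈-snoc : ∀ {L w} u → w ∉ L →
                     indicator (u ∈? L ++ w ∷ []) ≡ indicator (u ∈? L) + indicator (u ≟ᵛ w)
  indicator-∈-snoc {L} {w} u w∉L with u ∈? L | u ≟ᵛ w
  ... | yes u∈L | yes refl = ⊥-elim (w∉L u∈L)
  ... | yes u∈L | no _     = indicator-yes (u ∈? L ++ w ∷ []) (∈-++⁺ˡ u∈L)
  ... | no _    | yes refl = indicator-yes (u ∈? L ++ w ∷ []) (∈-++⁺ʳ L (here refl))
  ... | no u∉L  | no u≢w   = indicator-no (u ∈? L ++ w ∷ [])
                               λ u∈ → [ u∉L , (λ { (here u≡w) → u≢w u≡w }) ]′ (∈-++⁻ L u∈)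

  sum-indicator-box : ∀ k w → ∑[ j < 4 ] indicator ((k , j) ≟ᵛ w) ≡ indicator (k ≟ box w)
  sum-indicator-box k (i , j₀) = split (k ≟ i)
    where
      split : (k≟i : Dec (k ≡ i)) → ∑[ j < 4 ] indicator ((k , j) ≟ᵛ (i , j₀)) ≡ indicator k≟i
      split (yes k≡i) = begin
        ∑[ j < 4 ] indicator ((k , j) ≟ᵛ (i , j₀))
          ≡⟨ sum-cong-≗ (λ j → indicator-cong (cong proj₂) (cong₂ _,_ k≡i) ((k , j) ≟ᵛ (i , j₀)) (j ≟ j₀)) ⟩
        ∑[ j < 4 ] indicator (j ≟ j₀)
          ≡⟨ sum-indicator-≟ j₀ ⟩
        1 ∎
      split (no k≢i) = sum-zero λ j → indicator-no ((k , j) ≟ᵛ (i , j₀)) (k≢i ∘ cong proj₁)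

  boxCount-snoc : ∀ {L w} k → w ∉ L → boxCount (L ++ w ∷ []) k ≡ boxCount L k + indicator (k ≟ box w)
  boxCount-snoc {L} {w} k w∉L = begin
    ∑[ j < 4 ] indicator ((k , j) ∈? L ++ w ∷ [])
      ≡⟨ sum-cong-≗ (λ j → indicator-∈-snoc (k , j) w∉L) ⟩
    ∑[ j < 4 ] (indicator ((k , j) ∈? L) + indicator ((k , j) ≟ᵛ w))
      ≡⟨ ∑-distrib-+ (λ j → indicator ((k , j) ∈? L)) (λ j → indicator ((k , j) ≟ᵛ w)) ⟩
    boxCount L k + ∑[ j < 4 ] indicator ((k , j) ≟ᵛ w)
      ≡⟨ cong (boxCount L k +_) (sum-indicator-box k w) ⟩
    boxCount L k + indicator (k ≟ box w) ∎

  totalCount-snoc : ∀ {L w} → w ∉ L → totalCount (L ++ w ∷ []) ≡ totalCount L + 1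
  totalCount-snoc {L} {w} w∉L = begin
    ∑[ k < n ] boxCount (L ++ w ∷ []) k            ≡⟨ sum-cong-≗ (λ k → boxCount-snoc k w∉L) ⟩
    ∑[ k < n ] (boxCount L k + indicator (k ≟ box w)) ≡⟨ ∑-distrib-+ (boxCount L) (λ k → indicator (k ≟ box w)) ⟩
    totalCount L + ∑[ k < n ] indicator (k ≟ box w) ≡⟨ cong (totalCount L +_) (sum-indicator-≟ (box w)) ⟩
    totalCount L + 1                                ∎

  three-of-four : ∀ {L : List (Vertex n)} {k}
                  (d₀ : Dec (a k ∈ L)) (d₁ : Dec (s k ∈ L)) (d₂ : Dec (xv k ∈ L)) (d₃ : Dec (x̄v k ∈ L)) →
                  3 ≤ indicator d₀ + (indicator d₁ + (indicator d₂ + (indicator d₃ + 0))) →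
                  Any (All (_∈ L)) (boxTriples k)
  three-of-four (no _)   (yes p₁) (yes p₂) (yes p₃) _ = here (p₁ ∷ p₂ ∷ p₃ ∷ [])
  three-of-four (yes p₀) (no _)   (yes p₂) (yes p₃) _ = there (here (p₀ ∷ p₂ ∷ p₃ ∷ []))
  three-of-four (yes p₀) (yes p₁) (no _)   (yes p₃) _ = there (there (here (p₀ ∷ p₁ ∷ p₃ ∷ [])))
  three-of-four (yes p₀) (yes p₁) (yes p₂) _        _ = there (there (there (here (p₀ ∷ p₁ ∷ p₂ ∷ []))))
  three-of-four (yes _) (yes _) (no _)  (no _)  (s≤s (s≤s ()))
  three-of-four (yes _) (no _)  (yes _) (no _)  (s≤s (s≤s ()))
  three-of-four (yes _) (no _)  (no _)  (yes _) (s≤s (s≤s ()))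
  three-of-four (no _)  (yes _) (yes _) (no _)  (s≤s (s≤s ()))
  three-of-four (no _)  (yes _) (no _)  (yes _) (s≤s (s≤s ()))
  three-of-four (no _)  (no _)  (yes _) (yes _) (s≤s (s≤s ()))
  three-of-four (yes _) (no _)  (no _)  (no _)  (s≤s ())
  three-of-four (no _)  (yes _) (no _)  (no _)  (s≤s ())
  three-of-four (no _)  (no _)  (yes _) (no _)  (s≤s ())
  three-of-four (no _)  (no _)  (no _)  (yes _) (s≤s ())
  three-of-four (no _)  (no _)  (no _)  (no _)  ()

  boxCount≥3⇒loses : ∀ (φ : Formula n) L k → 3 ≤ boxCount L k → AvoiderLoses φ L
  boxCount≥3⇒loses φ L k 3≤count = ++⁺ˡ (concatMap⁺ boxTriples (lose (∈-allIdx n k)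
    (three-of-four (a k ∈? L) (s k ∈? L) (xv k ∈? L) (x̄v k ∈? L) 3≤count)))

  unclaimed-in-box? : ∀ h k → (∀ j → (k , j) ∈ h) ⊎ ∃ λ j → (k , j) ∉ h
  unclaimed-in-box? h k = all-or-counterexample (λ j → (k , j) ∈? h)

  unclaimed? : ∀ h → (∀ u → u ∈ h) ⊎ ∃ λ u → u ∉ h
  unclaimed? h with all-or-counterexample (λ k → all? (λ j → (k , j) ∈? h))
  ... | inj₁ full = inj₁ λ (k , j) → full k j
  ... | inj₂ (k , ¬full) with unclaimed-in-box? h k
  ...   | inj₁ full        = ⊥-elim (¬full full)
  ...   | inj₂ (j , free)  = inj₂ ((k , j) , free)

enforcerMoves : ∀ {A : Set} → List A → List A
enforcerMoves []          = []
enforcerMoves (x ∷ [])    = x ∷ []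
enforcerMoves (x ∷ _ ∷ r) = x ∷ enforcerMoves r

data EvenLength {A : Set} : List A → Set where
  even[]  : EvenLength []
  even∷∷ : ∀ x y {r} → EvenLength r → EvenLength (x ∷ y ∷ r)

module _ {A : Set} where

  evenLength-round : ∀ {h : List A} v w → EvenLength h → EvenLength (h ++ v ∷ w ∷ [])
  evenLength-round v w even[]         = even∷∷ v w even[]
  evenLength-round v w (even∷∷ x y e) = even∷∷ x y (evenLength-round v w e)

  avoiderMoves-round : ∀ {h : List A} v w → EvenLength h →
                       avoiderMoves (h ++ v ∷ w ∷ []) ≡ avoiderMoves h ++ w ∷ []
  avoiderMoves-round v w even[]         = refl
  avoiderMoves-round v w (even∷∷ _ y e) = cong (y ∷_) (avoiderMoves-round v w e)

  enforcerMoves-round : ∀ {h : List A} v w → EvenLength h →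
                        enforcerMoves (h ++ v ∷ w ∷ []) ≡ enforcerMoves h ++ v ∷ []
  enforcerMoves-round v w even[]         = refl
  enforcerMoves-round v w (even∷∷ x _ e) = cong (x ∷_) (enforcerMoves-round v w e)

  avoiderMoves-⊆ : (h : List A) → avoiderMoves h ⊆ h
  avoiderMoves-⊆ (_ ∷ _ ∷ r) (here p)  = there (here p)
  avoiderMoves-⊆ (_ ∷ _ ∷ r) (there p) = there (there (avoiderMoves-⊆ r p))

  enforcerMoves-⊆ : (h : List A) → enforcerMoves h ⊆ h
  enforcerMoves-⊆ (_ ∷ [])    (here p)  = here p
  enforcerMoves-⊆ (_ ∷ _ ∷ r) (here p)  = here p
  enforcerMoves-⊆ (_ ∷ _ ∷ r) (there p) = there (there (enforcerMoves-⊆ r p))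

  ∈-moves : ∀ (h : List A) {x} → x ∈ h → x ∈ avoiderMoves h ⊎ x ∈ enforcerMoves h
  ∈-moves (_ ∷ [])    (here p)          = inj₂ (here p)
  ∈-moves (_ ∷ _ ∷ r) (here p)          = inj₂ (here p)
  ∈-moves (_ ∷ _ ∷ r) (there (here p))  = inj₁ (here p)
  ∈-moves (_ ∷ _ ∷ r) (there (there p)) with ∈-moves r p
  ... | inj₁ p′ = inj₁ (there p′)
  ... | inj₂ p′ = inj₂ (there p′)

module Play {n : ℕ} (σ : AvoiderStrategy n) (legal : LegalStrategy σ) where

  answer : List (Vertex n) → Vertex n → Vertex n
  answer h v = σ (h ++ v ∷ [])

  afterRound : List (Vertex n) → Vertex n → List (Vertex n)
  afterRound h v = h ++ v ∷ answer h v ∷ []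

  reach-even : ∀ {h} → Reach σ h → EvenLength h
  reach-even start                  = even[]
  reach-even (round {h} {v} r v∉h) = evenLength-round v _ (reach-even r)

  module _ {h v} (r : Reach σ h) (v∉h : v ∉ h) where

    answer∉ : answer h v ∉ h
    answer∉ = legal h v r v∉h ∘ ∈-++⁺ˡ

    answer≢ : answer h v ≢ v
    answer≢ w≡v = legal h v r v∉h (∈-++⁺ʳ h (here w≡v))

    avoiderMoves-afterRound : avoiderMoves (afterRound h v) ≡ avoiderMoves h ++ answer h v ∷ []
    avoiderMoves-afterRound = avoiderMoves-round v _ (reach-even r)

    enforcerMoves-afterRound : enforcerMoves (afterRound h v) ≡ enforcerMoves h ++ v ∷ []
    enforcerMoves-afterRound = enforcerMoves-round v _ (reach-even r)

    boxCount-avoider-round : ∀ k → boxCount (avoiderMoves (afterRound h v)) k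
                                   ≡ boxCount (avoiderMoves h) k + indicator (k ≟ box (answer h v))
    boxCount-avoider-round k = trans (cong (λ L → boxCount L k) avoiderMoves-afterRound)
                                     (boxCount-snoc k (answer∉ ∘ avoiderMoves-⊆ h))

    boxCount-enforcer-round : ∀ k → boxCount (enforcerMoves (afterRound h v)) k
                                    ≡ boxCount (enforcerMoves h) k + indicator (k ≟ box v)
    boxCount-enforcer-round k = trans (cong (λ L → boxCount L k) enforcerMoves-afterRound)
                                      (boxCount-snoc k (v∉h ∘ enforcerMoves-⊆ h))

    totalCount-avoider-round : totalCount (avoiderMoves (afterRound h v)) ≡ totalCount (avoiderMoves h) + 1
    totalCount-avoider-round = trans (cong totalCount avoiderMoves-afterRound)
                                     (totalCount-snoc (answer∉ ∘ avoiderMoves-⊆ h))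

    totalCount-enforcer-round : totalCount (enforcerMoves (afterRound h v)) ≡ totalCount (enforcerMoves h) + 1
    totalCount-enforcer-round = trans (cong totalCount enforcerMoves-afterRound)
                                      (totalCount-snoc (v∉h ∘ enforcerMoves-⊆ h))

  reach-totalCount : ∀ {h} → Reach σ h → totalCount (avoiderMoves h) ≡ totalCount (enforcerMoves h)
  reach-totalCount start = refl
  reach-totalCount (round {h} {v} r v∉h) = begin
    totalCount (avoiderMoves (afterRound h v))  ≡⟨ totalCount-avoider-round r v∉h ⟩
    totalCount (avoiderMoves h) + 1             ≡⟨ cong (_+ 1) (reach-totalCount r) ⟩
    totalCount (enforcerMoves h) + 1            ≡⟨ totalCount-enforcer-round r v∉h ⟨
    totalCount (enforcerMoves (afterRound h v)) ∎

  reach-disjoint : ∀ {h x} → Reach σ h → x ∈ avoiderMoves h → x ∉ enforcerMoves h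
  reach-disjoint start ()
  reach-disjoint (round {h} {v} r v∉h) x∈A x∈E
    with ∈-++⁻ (avoiderMoves h) (subst (_ ∈_) (avoiderMoves-afterRound r v∉h) x∈A)
       | ∈-++⁻ (enforcerMoves h) (subst (_ ∈_) (enforcerMoves-afterRound r v∉h) x∈E)
  ... | inj₁ x∈A′         | inj₁ x∈E′         = reach-disjoint r x∈A′ x∈E′
  ... | inj₁ x∈A′         | inj₂ (here refl)  = v∉h (avoiderMoves-⊆ h x∈A′)
  ... | inj₂ (here refl)  | inj₁ x∈E′         = answer∉ r v∉h (enforcerMoves-⊆ h x∈E′)
  ... | inj₂ (here refl)  | inj₂ (here w≡v)   = answer≢ r v∉h w≡v

  indicator-moves : ∀ {h x} → Reach σ h → x ∈ h →
                    indicator (x ∈? avoiderMoves h) + indicator (x ∈? enforcerMoves h) ≡ 1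
  indicator-moves {h} {x} r x∈h with ∈-moves h x∈h
  ... | inj₁ x∈A = cong₂ _+_ (indicator-yes (x ∈? avoiderMoves h) x∈A)
                             (indicator-no (x ∈? enforcerMoves h) (reach-disjoint r x∈A))
  ... | inj₂ x∈E = cong₂ _+_ (indicator-no (x ∈? avoiderMoves h) (λ x∈A → reach-disjoint r x∈A x∈E))
                             (indicator-yes (x ∈? enforcerMoves h) x∈E)

  boxCount-full : ∀ {h k} → Reach σ h → (∀ j → (k , j) ∈ h) →
                  boxCount (avoiderMoves h) k + boxCount (enforcerMoves h) k ≡ 4
  boxCount-full {h} {k} r full = trans
    (sym (∑-distrib-+ (λ j → indicator ((k , j) ∈? avoiderMoves h)) (λ j → indicator ((k , j) ∈? enforcerMoves h))))
    (sum-cong-≗ λ j → indicator-moves r (full j))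

  EnforcerAhead : Fin n → List (Vertex n) → Set
  EnforcerAhead i h = boxCount (avoiderMoves h) i < boxCount (enforcerMoves h) i

  Balanced : List (Vertex n) → Set
  Balanced h = ∀ k → boxCount (avoiderMoves h) k ≡ boxCount (enforcerMoves h) k

  enforcerAhead-round : ∀ {h v i} (r : Reach σ h) (v∉h : v ∉ h) →
                        boxCount (avoiderMoves h) i + indicator (i ≟ box (answer h v))
                          < boxCount (enforcerMoves h) i + indicator (i ≟ box v) →
                        EnforcerAhead i (afterRound h v)
  enforcerAhead-round r v∉h =
    subst₂ _<_ (sym (boxCount-avoider-round r v∉h _)) (sym (boxCount-enforcer-round r v∉h _))

  enforcerAhead-move : ∀ {h i u} → Reach σ h → EnforcerAhead i h → u ∉ h →
                       ∃ λ v → Σ[ v∉h ∈ v ∉ h ] EnforcerAhead i (afterRound h v)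
  enforcerAhead-move {h} {i} {u} r ahead u∉h with unclaimed-in-box? h i
  ... | inj₂ (j , free) = (i , j) , free , enforcerAhead-round r free
        (+-mono-<-≤ ahead (indicator-mono (λ _ → refl) (i ≟ box (answer h (i , j))) (i ≟ i)))
  ... | inj₁ full       = u , u∉h , enforcerAhead-round r u∉h
        (+-mono-<-≤ ahead (indicator-mono (λ { refl → ⊥-elim (answer∉ r u∉h (full _)) })
                                          (i ≟ box (answer h u)) (i ≟ box u)))

module Winning {n : ℕ} (φ : Formula n) (σ : AvoiderStrategy n) (win : AvoiderWinning φ σ) where

  open Play σ (proj₁ win)

  boxCount≤2 : ∀ {h} → Reach σ h → (∀ u → u ∈ h) → ∀ k → boxCount (avoiderMoves h) k ≤ 2
  boxCount≤2 {h} r finished k with 3 ≤? boxCount (avoiderMoves h) k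
  ... | yes 3≤count = ⊥-elim (proj₂ win h r finished (boxCount≥3⇒loses φ _ k 3≤count))
  ... | no  3≰count = ≤-pred (≰⇒> 3≰count)

  finished-¬enforcerAhead : ∀ {h} → Reach σ h → (∀ u → u ∈ h) → ∀ i → ¬ EnforcerAhead i h
  finished-¬enforcerAhead {h} r finished i ahead =
    <-irrefl (reach-totalCount r) (sum-mono-< avoider≤enforcer i ahead)
    where
      avoider≤enforcer : ∀ k → boxCount (avoiderMoves h) k ≤ boxCount (enforcerMoves h) k
      avoider≤enforcer k = +-cancelˡ-≤ A A E (subst (A + A ≤_) (sym (boxCount-full r (λ j → finished (k , j))))
                                                  (+-mono-≤ (boxCount≤2 r finished k) (boxCount≤2 r finished k)))
        where A = boxCount (avoiderMoves h) k
              E = boxCount (enforcerMoves h) k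

  -- The fuel m bounds the number of remaining rounds, as the total Avoider count rises by one per round.
  ¬enforcerAhead : ∀ m {h} i → Reach σ h → boardSize n ≤ totalCount (avoiderMoves h) + m → ¬ EnforcerAhead i h
  ¬enforcerAhead m {h} i r fuel ahead with unclaimed? h
  ... | inj₁ finished   = finished-¬enforcerAhead r finished i ahead
  ... | inj₂ (u , u∉h) with enforcerAhead-move r ahead u∉h
  ...   | v , v∉h , ahead′ = continue m fuel
    where
      total′ : totalCount (avoiderMoves (afterRound h v)) ≡ totalCount (avoiderMoves h) + 1
      total′ = totalCount-avoider-round r v∉h

      continue : ∀ m → boardSize n ≤ totalCount (avoiderMoves h) + m → ⊥
      continue zero    fuel = <⇒≱ (m<m+n _ (s≤s z≤n))
        (≤-trans (subst (_≤ boardSize n) total′ (totalCount≤boardSize (avoiderMoves (afterRound h v))))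
                 (subst (boardSize n ≤_) (+-identityʳ _) fuel))
      continue (suc m) fuel = ¬enforcerAhead m i (round r v∉h)
        (subst (boardSize n ≤_) (sym (trans (cong (_+ m) total′) (+-assoc _ 1 m))) fuel)
        ahead′

  mutual
    answers-in-box : ∀ {h v} → Reach σ h → v ∉ h → box (answer h v) ≡ box v
    answers-in-box {h} {v} r v∉h with box (answer h v) ≟ box v
    ... | yes same = same
    ... | no  other = ⊥-elim (¬enforcerAhead (boardSize n) (box v) (round r v∉h) (m≤n+m _ _) ahead)
      where
        ahead : EnforcerAhead (box v) (afterRound h v)
        ahead = enforcerAhead-round r v∉h
          (+-mono-≤-< (≤-reflexive (reach-balanced r (box v)))
                      (indicator-mono-< (other ∘ sym) refl (box v ≟ box (answer h v)) (box v ≟ box v)))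

    reach-balanced : ∀ {h} → Reach σ h → Balanced h
    reach-balanced start k = refl
    reach-balanced (round {h} {v} r v∉h) k = begin
      boxCount (avoiderMoves (afterRound h v)) k
        ≡⟨ boxCount-avoider-round r v∉h k ⟩
      boxCount (avoiderMoves h) k + indicator (k ≟ box (answer h v))
        ≡⟨ cong₂ _+_ (reach-balanced r k) (cong (λ b → indicator (k ≟ b)) (answers-in-box r v∉h)) ⟩
      boxCount (enforcerMoves h) k + indicator (k ≟ box v)
        ≡⟨ boxCount-enforcer-round r v∉h k ⟨
      boxCount (enforcerMoves (afterRound h v)) k ∎

lemma5 : (n : ℕ) (φ : Formula n) (σ : AvoiderStrategy n) →
         AvoiderWinning φ σ →
         ∀ h v → Reach σ h → v ∉ h →
         box (σ (h ++ v ∷ [])) ≡ box v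
lemma5 n φ σ win h v r v∉h = Winning.answers-in-box φ σ win r v∉h
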